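{- For every integer $d\ge 3$, the fractional chromatic number of the Keller graph is $\chi_{\mathrm{frac}}(G_d)=2^d$, and $\chi_{\mathrm{frac}}(G_2)=16/5$.
   Context: The Keller graph $G_d$ has as vertices the $4^d$ tuples in $\{0,1,2,3\}^d$; two tuples $u,v$ are adjacent iff they differ in at least two coordinates and there is at least one coordinate $i$ with $u_i-v_i\equiv 2\pmod 4$. $\chi_{\mathrm{frac}}$ denotes the fractional chromatic number. -}

module Defs where

open import Data.Nat as ℕ using (ℕ; zero; suc; _^_; _%_)
open import Data.Fin using (Fin; toℕ)
open import Data.Vec using (Vec; lookup)
open import Data.Bool using (Bool; true; false; if_then_else_)
open import Data.List using (List; []; _∷_)
open import Data.List.Relation.Unary.All using (All)
open import Data.Product using (_×_; _,_; ∃; ∃-syntax; Σ)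
open import Data.Integer using (+_)
open import Data.Rational using (ℚ; 0ℚ; 1ℚ; _+_; _≤_; _/_)
open import Relation.Binary.PropositionalEquality using (_≡_; _≢_)
open import Relation.Nullary using (¬_)
open import Relation.Nullary.Decidable using (⌊_⌋)
open import Data.Fin using (_≟_)

VSet : Set → Set
VSet V = V → Bool

Independent : {V : Set} → (V → V → Set) → VSet V → Set
Independent {V} Adj S = ∀ (u v : V) → S u ≡ true → S v ≡ true → ¬ Adj u v

WFamily : Set → Set
WFamily V = List (VSet V × ℚ)

totalWeight : {V : Set} → WFamily V → ℚ
totalWeight [] = 0ℚ
totalWeight ((S , w) ∷ c) = w + totalWeight c

coverage : {V : Set} → WFamily V → V → ℚ
coverage [] v = 0ℚ
coverage ((S , w) ∷ c) v = (if S v then w else 0ℚ) + coverage c v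

IsFracColouring : {V : Set} → (V → V → Set) → WFamily V → Set
IsFracColouring {V} Adj c =
  All (λ p → Independent Adj (Data.Product.proj₁ p) × (0ℚ ≤ Data.Product.proj₂ p)) c
  × (∀ (v : V) → 1ℚ ≤ coverage c v)

FracChromaticNumberIs : {V : Set} → (V → V → Set) → ℚ → Set
FracChromaticNumberIs {V} Adj r =
  (∃[ c ] (IsFracColouring Adj c × totalWeight c ≡ r))
  × (∀ (c : WFamily V) → IsFracColouring Adj c → r ≤ totalWeight c)

KVertex : ℕ → Set
KVertex d = Vec (Fin 4) d

numDiff : ∀ {d} → KVertex d → KVertex d → ℕ
numDiff Data.Vec.[] Data.Vec.[] = 0
numDiff (x Data.Vec.∷ u) (y Data.Vec.∷ v) = (if ⌊ x ≟ y ⌋ then 0 else 1) ℕ.+ numDiff u v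

KellerAdj : (d : ℕ) → KVertex d → KVertex d → Set
KellerAdj d u v =
  (2 ℕ.≤ numDiff u v)
  × (∃[ i ] ((toℕ (lookup u i) ℕ.+ 2) % 4 ≡ toℕ (lookup v i)))

-- Double counting: if every independent set of a graph on n vertices has at most α vertices,
-- summing the coverage of a fractional colouring over all vertices gives n ≤ α · weight, so
-- χ_frac ≥ n / α. For d ≥ 3, α(G_d) ≤ 2^d follows from α(G₃) ≤ 8, found by a certified
-- branch-and-bound search, and from α(G_{d+1}) ≤ 2 α(G_d): of two slices of an independent set
-- whose first coordinates differ by 2, either one is empty or both are the same single vertex.
-- Conversely, colouring each vertex by which half, {0,1} or {2,3}, each of its coordinates lies
-- in is proper, since coordinates differing by 2 lie in different halves; this attains
-- 4^d / 2^d. For G₂ the search gives α = 5, and the 16 translates of one independent 5-set,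
-- each of weight 1/5, attain 16/5.

module Submission where

open import Defs
open import Data.Bool as Bool using (Bool; true; false; if_then_else_; _∧_; _∨_; T)
open import Data.Bool.Properties using (T-∧; T-∨)
open import Data.Empty using (⊥-elim)
open import Data.Fin as Fin using (Fin; toℕ)
open import Data.List as List
  using (List; []; _∷_; _++_; map; length; filter; allFin; cartesianProductWith)
open import Data.List.Membership.Propositional using (_∈_)
open import Data.List.Relation.Unary.All as All using (All; []; _∷_)
open import Data.List.Relation.Unary.Unique.Propositional using (Unique)
open import Data.Nat as ℕ using (ℕ; zero; suc)
open import Data.Product using (_×_; _,_; proj₁; proj₂; ∃-syntax)
open import Data.Sum using (_⊎_; inj₁; inj₂; [_,_]′)
open import Data.Vec as Vec using (Vec; lookup)
open import Function using (_∘_)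
open import Function.Bundles using (Equivalence)
open import Relation.Binary using (Decidable; DecidableEquality)
open import Relation.Binary.PropositionalEquality
open import Relation.Nullary using (Dec; yes; no; ¬_; ¬?; does)
open import Relation.Nullary.Decidable using (map′; _→-dec_)

module FiniteGraphs where
  open import Data.Nat using (_+_; _*_; _^_; _≤_; _≤ᵇ_; z≤n; s≤s)
  open import Data.Nat.Properties using (≤-trans; m≤n⇒m≤1+n; ≤ᵇ⇒≤)
  open import Data.Nat.ListAction using (sum)
  open import Data.List.Properties using (length-++; length-map)
  open import Data.List.Relation.Unary.AllPairs using ([]; _∷_)
  open import Data.List.Relation.Unary.Any using (here)
  import Data.List.Relation.Unary.Any.Properties as Any
  import Data.List.Relation.Unary.Unique.Propositional.Properties as Unique
  open import Data.Vec.Properties using (∷-injective)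

  module _ {V : Set} where

    -- Counted with multiplicity: this is the size of S only when vs is duplicate-free.
    ∣_∩_∣ : VSet V → List V → ℕ
    ∣ S ∩ [] ∣ = 0
    ∣ S ∩ v ∷ vs ∣ = if S v then suc ∣ S ∩ vs ∣ else ∣ S ∩ vs ∣

    ∣∩∣-++ : ∀ S xs ys → ∣ S ∩ xs ++ ys ∣ ≡ ∣ S ∩ xs ∣ + ∣ S ∩ ys ∣
    ∣∩∣-++ S [] ys = refl
    ∣∩∣-++ S (x ∷ xs) ys with S x
    ... | true = cong suc (∣∩∣-++ S xs ys)
    ... | false = ∣∩∣-++ S xs ys

    ∣∩∣≤length : ∀ S vs → ∣ S ∩ vs ∣ ≤ length vs
    ∣∩∣≤length S [] = z≤n
    ∣∩∣≤length S (v ∷ vs) with S v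
    ... | true = s≤s (∣∩∣≤length S vs)
    ... | false = m≤n⇒m≤1+n (∣∩∣≤length S vs)

    ∣∩∣-filter : ∀ S {P : V → Set} (P? : ∀ v → Dec (P v)) →
                 (∀ v → S v ≡ true → P v) → ∀ vs → ∣ S ∩ filter P? vs ∣ ≡ ∣ S ∩ vs ∣
    ∣∩∣-filter S P? S⊆P [] = refl
    ∣∩∣-filter S P? S⊆P (v ∷ vs) with P? v
    ... | yes _ = cong (λ n → if S v then suc n else n) (∣∩∣-filter S P? S⊆P vs)
    ... | no ¬Pv with S v in Sv
    ...   | true = ⊥-elim (¬Pv (S⊆P v Sv))
    ...   | false = ∣∩∣-filter S P? S⊆P vs

    ∣∩∣≡0⊎member : ∀ S vs → ∣ S ∩ vs ∣ ≡ 0 ⊎ ∃[ v ] S v ≡ true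
    ∣∩∣≡0⊎member S [] = inj₁ refl
    ∣∩∣≡0⊎member S (v ∷ vs) with S v in Sv
    ... | true = inj₂ (v , Sv)
    ... | false = ∣∩∣≡0⊎member S vs

    ∣∩∣≡0 : ∀ S {vs} → All (λ v → S v ≢ true) vs → ∣ S ∩ vs ∣ ≡ 0
    ∣∩∣≡0 S [] = refl
    ∣∩∣≡0 S {v ∷ _} (v∉S ∷ vs∉S) with S v
    ... | true = ⊥-elim (v∉S refl)
    ... | false = ∣∩∣≡0 S vs∉S

    ∣∩∣-subsingleton : ∀ S y {vs} → Unique vs → (∀ v → S v ≡ true → v ≡ y) → ∣ S ∩ vs ∣ ≤ 1
    ∣∩∣-subsingleton S y [] S⊆y = z≤n
    ∣∩∣-subsingleton S y {v ∷ vs} (v∉vs ∷ unique) S⊆y with S v in Sv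
    ... | true = s≤s (subst (_≤ 0) (sym (∣∩∣≡0 S (All.map v∉S v∉vs))) z≤n)
      where
      v∉S : ∀ {u} → v ≢ u → S u ≢ true
      v∉S v≢u Su = v≢u (trans (S⊆y v Sv) (sym (S⊆y _ Su)))
    ... | false = ∣∩∣-subsingleton S y unique S⊆y

  IndependenceNumber≤ : {V : Set} → (V → V → Set) → List V → ℕ → Set
  IndependenceNumber≤ Adj vs k = ∀ S → Independent Adj S → ∣ S ∩ vs ∣ ≤ k

  module _ {V : Set} {_~_ : V → V → Set} (_~?_ : Decidable _~_) where

    -- Branch and bound on the first vertex v: either v is left out, or it is taken and only its
    -- non-neighbours stay available; a list of at most k vertices needs no further search.
    independenceNumber≤? : ℕ → List V → Bool
    independenceNumber≤? k [] = true
    independenceNumber≤? zero (v ∷ vs) = false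
    independenceNumber≤? (suc k) (v ∷ vs) =
      (length vs ≤ᵇ k)
      ∨ (independenceNumber≤? (suc k) vs ∧ independenceNumber≤? k (filter (λ u → ¬? (v ~? u)) vs))

    ∣∩∣-branch : ∀ {k} S → Independent _~_ S → ∀ v vs →
                 ∣ S ∩ vs ∣ ≤ suc k → ∣ S ∩ filter (λ u → ¬? (v ~? u)) vs ∣ ≤ k → ∣ S ∩ v ∷ vs ∣ ≤ suc k
    ∣∩∣-branch S S-indep v vs without-v with-v with S v in Sv
    ... | false = without-v
    ... | true = s≤s (subst (_≤ _) (∣∩∣-filter S (λ u → ¬? (v ~? u)) (λ u → S-indep v u Sv) vs) with-v)

    independenceNumber≤-sound : ∀ k vs → T (independenceNumber≤? k vs) → IndependenceNumber≤ _~_ vs k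
    independenceNumber≤-sound k [] ok S S-indep = z≤n
    -- No `with` here: it would hide the lexicographic descent on (k, vs) from the termination checker.
    independenceNumber≤-sound (suc k) (v ∷ vs) ok S S-indep =
      [ (λ short → ≤-trans (∣∩∣≤length S (v ∷ vs)) (s≤s (≤ᵇ⇒≤ (length vs) k short)))
      , (λ ok-both → let ok-without , ok-with = Equivalence.to T-∧ ok-both in
           ∣∩∣-branch S S-indep v vs
             (independenceNumber≤-sound (suc k) vs ok-without S S-indep)
             (independenceNumber≤-sound k (filter (λ u → ¬? (v ~? u)) vs) ok-with S S-indep))
      ]′ (Equivalence.to T-∨ ok)

  module _ {V : Set} {vs : List V} (complete : ∀ v → v ∈ vs) where

    everywhere : {P : V → Set} → All P vs → ∀ v → P v
    everywhere ps v = All.lookup ps (complete v)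

    independent? : {Adj : V → V → Set} → Decidable Adj → (S : VSet V) → Dec (Independent Adj S)
    independent? adj? S = map′ (λ ok u v → everywhere (everywhere ok u) v)
                               (λ indep → All.tabulate λ {u} _ → All.tabulate λ {v} _ → indep u v)
      (All.all? (λ u → All.all? (λ v → (S u Bool.≟ true) →-dec (S v Bool.≟ true) →-dec ¬? (adj? u v)) vs) vs)

  module _ {A B C : Set} where

    ∣∩∣-cartesianProductWith : ∀ (S : VSet C) (f : A → B → C) xs ys →
      ∣ S ∩ cartesianProductWith f xs ys ∣ ≡ sum (map (λ x → ∣ S ∘ f x ∩ ys ∣) xs)
    ∣∩∣-cartesianProductWith S f [] ys = refl
    ∣∩∣-cartesianProductWith S f (x ∷ xs) ys = begin
      ∣ S ∩ map (f x) ys ++ cartesianProductWith f xs ys ∣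
        ≡⟨ ∣∩∣-++ S (map (f x) ys) _ ⟩
      ∣ S ∩ map (f x) ys ∣ + ∣ S ∩ cartesianProductWith f xs ys ∣
        ≡⟨ cong₂ _+_ (∣∩∣-map ys) (∣∩∣-cartesianProductWith S f xs ys) ⟩
      ∣ S ∘ f x ∩ ys ∣ + sum (map (λ x → ∣ S ∘ f x ∩ ys ∣) xs) ∎
      where
      open ≡-Reasoning
      ∣∩∣-map : ∀ zs → ∣ S ∩ map (f x) zs ∣ ≡ ∣ S ∘ f x ∩ zs ∣
      ∣∩∣-map [] = refl
      ∣∩∣-map (z ∷ zs) = cong (λ n → if S (f x z) then suc n else n) (∣∩∣-map zs)

    length-cartesianProductWith : ∀ (f : A → B → C) xs ys →
      length (cartesianProductWith f xs ys) ≡ length xs * length ys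
    length-cartesianProductWith f [] ys = refl
    length-cartesianProductWith f (x ∷ xs) ys = begin
      length (map (f x) ys ++ cartesianProductWith f xs ys)
        ≡⟨ length-++ (map (f x) ys) ⟩
      length (map (f x) ys) + length (cartesianProductWith f xs ys)
        ≡⟨ cong₂ _+_ (length-map (f x) ys) (length-cartesianProductWith f xs ys) ⟩
      length ys + length xs * length ys ∎
      where open ≡-Reasoning

  module _ {A : Set} where

    allVecs : List A → (d : ℕ) → List (Vec A d)
    allVecs xs zero = Vec.[] ∷ []
    allVecs xs (suc d) = cartesianProductWith Vec._∷_ xs (allVecs xs d)

    ∈-allVecs : ∀ {xs} → (∀ x → x ∈ xs) → ∀ {d} (v : Vec A d) → v ∈ allVecs xs d
    ∈-allVecs ∈xs Vec.[] = here refl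
    ∈-allVecs ∈xs (x Vec.∷ v) =
      Any.cartesianProductWith⁺ Vec._∷_ (λ { refl refl → refl }) (∈xs x) (∈-allVecs ∈xs v)

    allVecs-unique : ∀ {xs} → Unique xs → ∀ d → Unique (allVecs xs d)
    allVecs-unique xs! zero = [] ∷ []
    allVecs-unique xs! (suc d) = Unique.cartesianProductWith⁺ Vec._∷_ ∷-injective xs! (allVecs-unique xs! d)

    length-allVecs : ∀ xs d → length (allVecs xs d) ≡ length xs ^ d
    length-allVecs xs zero = refl
    length-allVecs xs (suc d) =
      trans (length-cartesianProductWith Vec._∷_ xs (allVecs xs d)) (cong (length xs *_) (length-allVecs xs d))

module FractionalColourings where
  import Data.Integer as ℤ
  import Data.Integer.Properties as ℤP
  open import Data.Nat using (NonZero)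
  open import Data.Nat.Coprimality using (1-coprimeTo) renaming (sym to coprime-sym)
  open import Data.Rational using (ℚ; mkℚ; 0ℚ; 1ℚ; _/_; _+_; _*_; _≤_; *≤*; Positive; nonNegative)
  open import Data.Rational.Properties
  open import Data.List.Membership.Propositional.Properties using (∈-map⁺)
  open import Data.List.Relation.Unary.All.Properties using (map⁺)
  open import Relation.Nullary.Decidable using (dec-true)
  open import Data.List.Relation.Unary.Any using (here; there)
  open import Algebra.Bundles using (CommutativeMonoid)
  open import Algebra.Properties.CommutativeSemigroup
    (CommutativeMonoid.commutativeSemigroup +-0-commutativeMonoid) using (interchange)
  open FiniteGraphs

  fromℕ : ℕ → ℚ
  fromℕ n = ℤ.+ n / 1

  fromℕ≡mkℚ : ∀ n → fromℕ n ≡ mkℚ (ℤ.+ n) 0 (coprime-sym (1-coprimeTo n))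
  fromℕ≡mkℚ n = normalize-coprime (coprime-sym (1-coprimeTo n))

  fromℕ-+ : ∀ m n → fromℕ (m ℕ.+ n) ≡ fromℕ m + fromℕ n
  fromℕ-+ m n rewrite fromℕ≡mkℚ m | fromℕ≡mkℚ n =
    cong (_/ 1) (trans (ℤP.pos-+ m n) (sym (cong₂ ℤ._+_ (ℤP.*-identityʳ (ℤ.+ m)) (ℤP.*-identityʳ (ℤ.+ n)))))

  fromℕ-* : ∀ m n → fromℕ (m ℕ.* n) ≡ fromℕ m * fromℕ n
  fromℕ-* m n rewrite fromℕ≡mkℚ m | fromℕ≡mkℚ n = cong (_/ 1) (ℤP.pos-* m n)

  fromℕ-mono-≤ : ∀ {m n} → m ℕ.≤ n → fromℕ m ≤ fromℕ n
  fromℕ-mono-≤ {m} {n} m≤n rewrite fromℕ≡mkℚ m | fromℕ≡mkℚ n =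
    *≤* (subst₂ ℤ._≤_ (sym (ℤP.*-identityʳ (ℤ.+ m))) (sym (ℤP.*-identityʳ (ℤ.+ n))) (ℤ.+≤+ m≤n))

  fromℕ-positive : ∀ n → .{{NonZero n}} → Positive (fromℕ n)
  fromℕ-positive (suc n) rewrite fromℕ≡mkℚ (suc n) = _

  ∑ : {A : Set} → List A → (A → ℚ) → ℚ
  ∑ [] f = 0ℚ
  ∑ (x ∷ xs) f = f x + ∑ xs f

  ∑-0 : {A : Set} (xs : List A) → ∑ xs (λ _ → 0ℚ) ≡ 0ℚ
  ∑-0 [] = refl
  ∑-0 (x ∷ xs) = trans (+-identityˡ _) (∑-0 xs)

  ∑-+ : {A : Set} (xs : List A) (f g : A → ℚ) → ∑ xs (λ x → f x + g x) ≡ ∑ xs f + ∑ xs g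
  ∑-+ [] f g = refl
  ∑-+ (x ∷ xs) f g = trans (cong ((f x + g x) +_) (∑-+ xs f g)) (interchange (f x) (g x) (∑ xs f) (∑ xs g))

  ∑-indicator : {V : Set} (S : VSet V) (w : ℚ) (vs : List V) →
                ∑ vs (λ v → if S v then w else 0ℚ) ≡ w * fromℕ ∣ S ∩ vs ∣
  ∑-indicator S w [] = sym (*-zeroʳ w)
  ∑-indicator S w (v ∷ vs) with S v
  ... | false = trans (+-identityˡ _) (∑-indicator S w vs)
  ... | true = begin
    w + ∑ vs (λ v → if S v then w else 0ℚ) ≡⟨ cong (w +_) (∑-indicator S w vs) ⟩
    w + w * fromℕ ∣ S ∩ vs ∣                ≡⟨ cong (_+ w * fromℕ ∣ S ∩ vs ∣) (sym (*-identityʳ w)) ⟩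
    w * 1ℚ + w * fromℕ ∣ S ∩ vs ∣           ≡⟨ sym (*-distribˡ-+ w 1ℚ _) ⟩
    w * (1ℚ + fromℕ ∣ S ∩ vs ∣)             ≡⟨ cong (w *_) (sym (fromℕ-+ 1 ∣ S ∩ vs ∣)) ⟩
    w * fromℕ (suc ∣ S ∩ vs ∣)              ∎
    where open ≡-Reasoning

  length≤∑ : {A : Set} (xs : List A) (f : A → ℚ) → (∀ x → 1ℚ ≤ f x) → fromℕ (length xs) ≤ ∑ xs f
  length≤∑ [] f 1≤f = ≤-refl
  length≤∑ (x ∷ xs) f 1≤f =
    subst (_≤ f x + ∑ xs f) (sym (fromℕ-+ 1 (length xs))) (+-mono-≤ (1≤f x) (length≤∑ xs f 1≤f))

  indicator-nonNeg : ∀ {w} b → 0ℚ ≤ w → 0ℚ ≤ (if b then w else 0ℚ)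
  indicator-nonNeg true 0≤w = 0≤w
  indicator-nonNeg false _ = ≤-refl

  module _ {V : Set} {Adj : V → V → Set} where

    ∑coverage≤ : ∀ vs {k} → IndependenceNumber≤ Adj vs k → ∀ c →
                 All (λ p → Independent Adj (proj₁ p) × (0ℚ ≤ proj₂ p)) c →
                 ∑ vs (coverage c) ≤ totalWeight c * fromℕ k
    ∑coverage≤ vs {k} α≤k [] [] = ≤-reflexive (trans (∑-0 vs) (sym (*-zeroˡ (fromℕ k))))
    ∑coverage≤ vs {k} α≤k ((S , w) ∷ c) ((S-indep , 0≤w) ∷ c-ok) = begin
      ∑ vs (λ v → (if S v then w else 0ℚ) + coverage c v)
        ≡⟨ ∑-+ vs _ (coverage c) ⟩
      ∑ vs (λ v → if S v then w else 0ℚ) + ∑ vs (coverage c)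
        ≡⟨ cong (_+ ∑ vs (coverage c)) (∑-indicator S w vs) ⟩
      w * fromℕ ∣ S ∩ vs ∣ + ∑ vs (coverage c)
        ≤⟨ +-mono-≤ (*-monoˡ-≤-nonNeg w {{nonNegative 0≤w}} (fromℕ-mono-≤ (α≤k S S-indep)))
                    (∑coverage≤ vs α≤k c c-ok) ⟩
      w * fromℕ k + totalWeight c * fromℕ k
        ≡⟨ sym (*-distribʳ-+ (fromℕ k) w (totalWeight c)) ⟩
      (w + totalWeight c) * fromℕ k ∎
      where open ≤-Reasoning

    fracChromatic≥ : ∀ vs {k r} → IndependenceNumber≤ Adj vs k → .{{NonZero k}} →
                     fromℕ (length vs) ≡ r * fromℕ k →
                     ∀ c → IsFracColouring Adj c → r ≤ totalWeight c
    fracChromatic≥ vs {k} α≤k n≡rk c (c-ok , covered) =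
      *-cancelʳ-≤-pos (fromℕ k) {{fromℕ-positive k}}
        (subst (_≤ totalWeight c * fromℕ k) n≡rk
          (≤-trans (length≤∑ vs (coverage c) covered) (∑coverage≤ vs α≤k c c-ok)))

    coverage-nonNeg : ∀ (c : WFamily V) v → All (λ p → 0ℚ ≤ proj₂ p) c → 0ℚ ≤ coverage c v
    coverage-nonNeg [] v [] = ≤-refl
    coverage-nonNeg ((S , w) ∷ c) v (0≤w ∷ c-ok) =
      +-mono-≤ (indicator-nonNeg (S v) 0≤w) (coverage-nonNeg c v c-ok)

    weight≤coverage : ∀ {S w} {c : WFamily V} {v} → All (λ p → 0ℚ ≤ proj₂ p) c → (S , w) ∈ c → S v ≡ true →
                      w ≤ coverage c v
    weight≤coverage {w = w} {c = _ ∷ c} {v} (_ ∷ c-ok) (here refl) Sv rewrite Sv =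
      subst (_≤ w + coverage c v) (+-identityʳ w) (+-monoʳ-≤ w (coverage-nonNeg c v c-ok))
    weight≤coverage {w = w} {c = (S′ , w′) ∷ c} {v} (0≤w′ ∷ c-ok) (there S∈c) Sv =
      subst (_≤ (if S′ v then w′ else 0ℚ) + coverage c v) (+-identityˡ w)
        (+-mono-≤ (indicator-nonNeg (S′ v) 0≤w′) (weight≤coverage c-ok S∈c Sv))

    colouring⇒fracColouring : {C : Set} → DecidableEquality C → (colours : List C) (f : V → C) →
                              (∀ v → f v ∈ colours) → (∀ u v → f u ≡ f v → ¬ Adj u v) →
                              ∃[ c ] IsFracColouring Adj c × totalWeight c ≡ fromℕ (length colours)
    colouring⇒fracColouring {C} _≟_ colours f f∈colours proper =
      classes , (map⁺ (All.tabulate λ _ → class-independent _ , 0≤1) , covered) , weight colours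
      where
      class : C → VSet V
      class x v = does (f v ≟ x)

      classes : WFamily V
      classes = map (λ x → class x , 1ℚ) colours

      0≤1 : 0ℚ ≤ 1ℚ
      0≤1 = nonNegative⁻¹ 1ℚ

      class-independent : ∀ x → Independent Adj (class x)
      class-independent x u v u∈x v∈x with f u ≟ x | f v ≟ x
      ... | yes fu≡x | yes fv≡x = proper u v (trans fu≡x (sym fv≡x))

      covered : ∀ v → 1ℚ ≤ coverage classes v
      covered v = weight≤coverage (map⁺ (All.tabulate λ _ → 0≤1))
                    (∈-map⁺ (λ x → class x , 1ℚ) (f∈colours v)) (dec-true (f v ≟ f v) refl)

      weight : ∀ xs → totalWeight (map (λ x → class x , 1ℚ) xs) ≡ fromℕ (length xs)
      weight [] = refl
      weight (x ∷ xs) = trans (cong (1ℚ +_) (weight xs)) (sym (fromℕ-+ 1 (length xs)))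

module Keller where
  open import Data.Nat using (_+_; _*_; _^_; _%_; _≤_; _≤′_; _≤?_; z≤n; s≤s; ≤′-refl; ≤′-step)
  open import Data.Nat.Properties using (≤-trans; +-mono-≤; +-identityʳ; n≢0⇒n>0; ^-monoʳ-≤; ≤′⇒≤)
  open import Data.Nat.Tactic.RingSolver using (solve-∀)
  open import Data.Fin.Patterns using (0F; 1F; 2F; 3F)
  open import Data.Fin.Properties using (any?; all?)
  open import Data.List.Membership.Propositional.Properties using (∈-allFin)
  open import Data.List.Relation.Unary.Unique.Propositional.Properties using (allFin⁺)
  open import Data.Vec.Properties using (≡-dec)
  open import Relation.Nullary.Decidable using (_×-dec_; decidable-stable; from-yes)
  open FiniteGraphs

  vertices : (d : ℕ) → List (KVertex d)
  vertices = allVecs (allFin 4)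

  ∈-vertices : ∀ {d} (v : KVertex d) → v ∈ vertices d
  ∈-vertices = ∈-allVecs ∈-allFin

  _≟ᵥ_ : ∀ {d} → DecidableEquality (KVertex d)
  _≟ᵥ_ = ≡-dec Fin._≟_

  vertices-unique : ∀ d → Unique (vertices d)
  vertices-unique = allVecs-unique (allFin⁺ 4)

  Antipodal : Fin 4 → Fin 4 → Set
  Antipodal a b = (toℕ a + 2) % 4 ≡ toℕ b

  antipodal? : Decidable Antipodal
  antipodal? a b = (toℕ a + 2) % 4 ℕ.≟ toℕ b

  keller? : ∀ d → Decidable (KellerAdj d)
  keller? d u v = (2 ≤? numDiff u v) ×-dec any? (λ i → antipodal? (lookup u i) (lookup v i))

  antipodal-irreflexive : ∀ a → ¬ Antipodal a a
  antipodal-irreflexive = from-yes (all? λ a → ¬? (antipodal? a a))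

  numDiff≡0⇒≡ : ∀ {d} (u v : KVertex d) → numDiff u v ≡ 0 → u ≡ v
  numDiff≡0⇒≡ Vec.[] Vec.[] _ = refl
  numDiff≡0⇒≡ (a Vec.∷ u) (b Vec.∷ v) eq with a Fin.≟ b
  ... | yes refl = cong (a Vec.∷_) (numDiff≡0⇒≡ u v eq)
  numDiff≡0⇒≡ (a Vec.∷ u) (b Vec.∷ v) () | no _

  numDiff-∷ : ∀ {d} a (u v : KVertex d) → numDiff (a Vec.∷ u) (a Vec.∷ v) ≡ numDiff u v
  numDiff-∷ a u v with a Fin.≟ a
  ... | yes _ = refl
  ... | no a≢a = ⊥-elim (a≢a refl)

  numDiff-∷-≢ : ∀ {d a b} (u v : KVertex d) → a ≢ b → numDiff (a Vec.∷ u) (b Vec.∷ v) ≡ suc (numDiff u v)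
  numDiff-∷-≢ {a = a} {b} u v a≢b with a Fin.≟ b
  ... | yes a≡b = ⊥-elim (a≢b a≡b)
  ... | no _ = refl

  slice : ∀ {d} → Fin 4 → VSet (KVertex (suc d)) → VSet (KVertex d)
  slice a S u = S (a Vec.∷ u)

  slice-independent : ∀ {d S} → Independent (KellerAdj (suc d)) S → ∀ a → Independent (KellerAdj d) (slice a S)
  slice-independent S-indep a u v Su Sv (2≤numDiff , i , antipodal) =
    S-indep _ _ Su Sv (subst (2 ≤_) (sym (numDiff-∷ a u v)) 2≤numDiff , Fin.suc i , antipodal)

  antipodal-slices-coincide : ∀ {d S a b} {u v : KVertex d} → Independent (KellerAdj (suc d)) S → Antipodal a b →
                          slice a S u ≡ true → slice b S v ≡ true → u ≡ v
  antipodal-slices-coincide {a = a} {u = u} {v} S-indep ab Su Sv =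
    decidable-stable (u ≟ᵥ v) λ u≢v → S-indep _ _ Su Sv (2≤numDiff u≢v , 0F , ab)
    where
    a≢b : a ≢ _
    a≢b refl = antipodal-irreflexive a ab
    2≤numDiff : u ≢ v → 2 ≤ numDiff (a Vec.∷ u) (_ Vec.∷ v)
    2≤numDiff u≢v = subst (2 ≤_) (sym (numDiff-∷-≢ u v a≢b)) (s≤s (n≢0⇒n>0 (u≢v ∘ numDiff≡0⇒≡ u v)))

  antipodal-slices-bounded : ∀ {d k S a b} → IndependenceNumber≤ (KellerAdj d) (vertices d) k → 2 ≤ k →
                             Independent (KellerAdj (suc d)) S → Antipodal a b →
                             ∣ slice a S ∩ vertices d ∣ + ∣ slice b S ∩ vertices d ∣ ≤ k
  antipodal-slices-bounded {d} {k} {S} {a} {b} α≤k 2≤k S-indep ab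
    with ∣∩∣≡0⊎member (slice a S) (vertices d) | ∣∩∣≡0⊎member (slice b S) (vertices d)
  ... | inj₁ a-empty | _ rewrite a-empty = α≤k (slice b S) (slice-independent S-indep b)
  ... | inj₂ _ | inj₁ b-empty rewrite b-empty | +-identityʳ ∣ slice a S ∩ vertices d ∣ =
    α≤k (slice a S) (slice-independent S-indep a)
  ... | inj₂ (x , Sx) | inj₂ (y , Sy) = ≤-trans (+-mono-≤ a-slice≤1 b-slice≤1) 2≤k
    where
    a-slice≤1 : ∣ slice a S ∩ vertices d ∣ ≤ 1
    a-slice≤1 = ∣∩∣-subsingleton (slice a S) y (vertices-unique d) λ u Su → antipodal-slices-coincide S-indep ab Su Sy
    b-slice≤1 : ∣ slice b S ∩ vertices d ∣ ≤ 1
    b-slice≤1 = ∣∩∣-subsingleton (slice b S) x (vertices-unique d) λ v Sv → sym (antipodal-slices-coincide S-indep ab Sx Sv)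

  m+[n+[o+[p+0]]]≡[m+o]+[n+p] : ∀ m n o p → m + (n + (o + (p + 0))) ≡ (m + o) + (n + p)
  m+[n+[o+[p+0]]]≡[m+o]+[n+p] = solve-∀

  independence-doubling : ∀ {d k} → IndependenceNumber≤ (KellerAdj d) (vertices d) k → 2 ≤ k →
                          IndependenceNumber≤ (KellerAdj (suc d)) (vertices (suc d)) (2 * k)
  independence-doubling {d} {k} α≤k 2≤k S S-indep = begin
    ∣ S ∩ vertices (suc d) ∣                 ≡⟨ ∣∩∣-cartesianProductWith S Vec._∷_ (allFin 4) (vertices d) ⟩
    c 0F + (c 1F + (c 2F + (c 3F + 0)))      ≡⟨ m+[n+[o+[p+0]]]≡[m+o]+[n+p] (c 0F) (c 1F) (c 2F) (c 3F) ⟩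
    (c 0F + c 2F) + (c 1F + c 3F)            ≤⟨ +-mono-≤ (antipodal-pair 0F 2F refl) (antipodal-pair 1F 3F refl) ⟩
    k + k                                    ≡⟨ cong (k +_) (sym (+-identityʳ k)) ⟩
    2 * k                                    ∎
    where
    open Data.Nat.Properties.≤-Reasoning
    c : Fin 4 → ℕ
    c a = ∣ slice a S ∩ vertices d ∣
    antipodal-pair : ∀ a b → Antipodal a b → c a + c b ≤ k
    antipodal-pair a b ab = antipodal-slices-bounded α≤k 2≤k S-indep ab

  α[G₂]≤5 : IndependenceNumber≤ (KellerAdj 2) (vertices 2) 5
  α[G₂]≤5 = independenceNumber≤-sound (keller? 2) 5 (vertices 2) _

  α[G₃]≤8 : IndependenceNumber≤ (KellerAdj 3) (vertices 3) 8
  α[G₃]≤8 = independenceNumber≤-sound (keller? 3) 8 (vertices 3) _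

  α[G_d]≤2^d : ∀ {d} → 3 ≤′ d → IndependenceNumber≤ (KellerAdj d) (vertices d) (2 ^ d)
  α[G_d]≤2^d ≤′-refl = α[G₃]≤8
  α[G_d]≤2^d (≤′-step 3≤d) =
    independence-doubling (α[G_d]≤2^d 3≤d) (^-monoʳ-≤ 2 (≤-trans (s≤s z≤n) (≤′⇒≤ 3≤d)))

module KellerColourings where
  open import Data.Integer using (+_)
  open import Data.Nat using (_^_)
  open import Data.Nat.DivMod using (_mod_)
  open import Data.Nat.Properties using ([m*n]*[o*p]≡[m*o]*[n*p])
  open import Data.Fin.Patterns using (0F; 1F; 2F; 3F)
  open import Data.Fin.Properties using (all?)
  open import Data.Vec.Properties using (≡-dec; lookup-map)
  open import Data.List.Relation.Unary.All.Properties using (map⁺)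
  open import Data.List.Relation.Unary.Any using (here; there)
  open import Data.Rational using (1ℚ; _/_; _*_; _≤_)
  open import Data.Rational.Properties using (_≤?_; nonNegative⁻¹)
  open import Relation.Nullary.Decidable using (from-yes)
  open FiniteGraphs
  open FractionalColourings
  open Keller
  open import Data.List.Membership.DecPropositional (_≟ᵥ_ {2}) using (_∈?_)

  4^n≡2^n*2^n : ∀ n → 4 ^ n ≡ 2 ^ n ℕ.* 2 ^ n
  4^n≡2^n*2^n zero = refl
  4^n≡2^n*2^n (suc n) = trans (cong (4 ℕ.*_) (4^n≡2^n*2^n n)) ([m*n]*[o*p]≡[m*o]*[n*p] 2 2 (2 ^ n) (2 ^ n))

  fromℕ-#vertices : ∀ d → fromℕ (length (vertices d)) ≡ fromℕ (2 ^ d) * fromℕ (2 ^ d)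
  fromℕ-#vertices d =
    trans (cong fromℕ (trans (length-allVecs (allFin 4) d) (4^n≡2^n*2^n d))) (fromℕ-* (2 ^ d) (2 ^ d))

  upperHalf : Fin 4 → Bool
  upperHalf a = 2 ℕ.≤ᵇ toℕ a

  antipodal⇒halves-differ : ∀ a b → Antipodal a b → upperHalf a ≢ upperHalf b
  antipodal⇒halves-differ =
    from-yes (all? λ a → all? λ b → antipodal? a b →-dec ¬? (upperHalf a Bool.≟ upperHalf b))

  halves : ∀ {d} → KVertex d → Vec Bool d
  halves = Vec.map upperHalf

  halves-proper : ∀ {d} (u v : KVertex d) → halves u ≡ halves v → ¬ KellerAdj d u v
  halves-proper u v halves≡ (_ , i , antipodal) =
    antipodal⇒halves-differ (lookup u i) (lookup v i) antipodal (begin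
    upperHalf (lookup u i) ≡⟨ lookup-map i upperHalf u ⟨
    lookup (halves u) i    ≡⟨ cong (λ w → lookup w i) halves≡ ⟩
    lookup (halves v) i    ≡⟨ lookup-map i upperHalf v ⟩
    upperHalf (lookup v i) ∎)
    where open ≡-Reasoning

  bits : List Bool
  bits = true ∷ false ∷ []

  ∈bits : ∀ b → b ∈ bits
  ∈bits true = here refl
  ∈bits false = there (here refl)

  halves-fracColouring : ∀ d → ∃[ c ] IsFracColouring (KellerAdj d) c × totalWeight c ≡ fromℕ (2 ^ d)
  halves-fracColouring d
    with colouring⇒fracColouring (≡-dec Bool._≟_) (allVecs bits d) halves (∈-allVecs ∈bits ∘ halves) halves-proper
  ... | c , c-ok , weight = c , c-ok , trans weight (cong fromℕ (length-allVecs bits d))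

  _⊕_ : Fin 4 → Fin 4 → Fin 4
  a ⊕ b = (toℕ a ℕ.+ toℕ b) mod 4

  -- An independent set of size α(G₂) = 5 whose 16 translates cover every vertex five times.
  pentad : List (KVertex 2)
  pentad = (0F Vec.∷ 0F Vec.∷ Vec.[]) ∷ (0F Vec.∷ 1F Vec.∷ Vec.[]) ∷ (0F Vec.∷ 2F Vec.∷ Vec.[])
         ∷ (1F Vec.∷ 1F Vec.∷ Vec.[]) ∷ (3F Vec.∷ 1F Vec.∷ Vec.[]) ∷ []

  translate : KVertex 2 → VSet (KVertex 2)
  translate t v = does (v ∈? map (Vec.zipWith _⊕_ t) pentad)

  translates : WFamily (KVertex 2)
  translates = map (λ t → translate t , + 1 / 5) (vertices 2)

  translates-fracColouring : IsFracColouring (KellerAdj 2) translates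
  translates-fracColouring = map⁺ (All.map (_, nonNegative⁻¹ (+ 1 / 5)) translates-independent)
                           , everywhere ∈-vertices covered
    where
    translates-independent : All (λ t → Independent (KellerAdj 2) (translate t)) (vertices 2)
    translates-independent =
      from-yes (All.all? (λ t → independent? ∈-vertices (keller? 2) (translate t)) (vertices 2))
    covered : All (λ v → 1ℚ ≤ coverage translates v) (vertices 2)
    covered = from-yes (All.all? (λ v → 1ℚ ≤? coverage translates v) (vertices 2))

open FractionalColourings using (fracChromatic≥)
open Keller using (vertices; α[G₂]≤5; α[G_d]≤2^d)
open KellerColourings using (fromℕ-#vertices; halves-fracColouring; translates; translates-fracColouring)
open import Data.Nat using (_≤_; _^_)
open import Data.Nat.Properties using (≤⇒≤′; m^n≢0)
open import Data.Integer using (+_)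
open import Data.Rational using (_/_)

corollary21 : ((d : ℕ) → 3 ≤ d → FracChromaticNumberIs (KellerAdj d) ((+ (2 ^ d)) / 1))
    × FracChromaticNumberIs (KellerAdj 2) ((+ 16) / 5)
corollary21 =
  (λ d 3≤d → halves-fracColouring d
           , fracChromatic≥ (vertices d) (α[G_d]≤2^d (≤⇒≤′ 3≤d)) {{m^n≢0 2 d}} (fromℕ-#vertices d))
  , (translates , translates-fracColouring , refl)
  , fracChromatic≥ (vertices 2) α[G₂]≤5 refl
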